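{- Let $\langle P,\wedge,\vee,0,1,\circ\rangle$ be a universale such that the operation $\circ$ is idempotent (i.e. $a\circ a=a$ for all $a\in P$) and such that the least element $0$ of the lattice coincides with the identity element $0'$ of the monoid $\langle P,\circ\rangle$. Then $\langle P,\wedge,\vee,0,1\rangle$ is a globale.
   Context: A universale is a structure $\langle P,\wedge,\vee,0,1,\circ\rangle$ such that: (1) $\langle P,\wedge,\vee\rangle$ is a complete lattice with least element $0$ and greatest element $1$; (2) $\langle P,\circ\rangle$ is a monoid, with identity element denoted $0'$; (3) for every $b\in P$ and every $T\subseteq P$: $b\circ\bigwedge T=\bigwedge\{b\circ t\mid t\in T\}$ and $(\bigwedge T)\circ b=\bigwedge\{t\circ b\mid t\in T\}$. A globale is a complete lattice $L$ such that for every $w\in L$ and every $Z\subseteq L$: $w\vee\bigwedge Z=\bigwedge\{w\vee z\mid z\in Z\}$. -}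

module Defs where

open import Level using (Level; _⊔_) renaming (suc to lsuc)
open import Relation.Unary using (Pred; _∈_)
open import Relation.Binary.Core using (Rel)
open import Relation.Binary.PropositionalEquality using (_≡_)
open import Relation.Binary.Structures using (IsPartialOrder)
open import Relation.Binary.Lattice.Definitions using (Infimum; Supremum)
open import Algebra.Structures using (IsMonoid)

image : ∀ {a ℓ} {A : Set a} → (A → A) → Pred A ℓ → Pred A (a ⊔ ℓ)
image {A = A} f T = λ x → Σ' A (λ t → (t ∈ T) × (f t ≡ x))
  where
  open import Data.Product using (_×_) renaming (Σ to Σ')

record CompleteLattice (a ℓ r : Level) : Set (lsuc (a ⊔ ℓ ⊔ r)) where
  field
    Carrier        : Set a
    _≤_            : Rel Carrier r
    isPartialOrder : IsPartialOrder _≡_ _≤_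
    ⋀              : Pred Carrier (a ⊔ ℓ) → Carrier
    ⋀-lower        : ∀ T {t} → t ∈ T → ⋀ T ≤ t
    ⋀-greatest     : ∀ T {x} → (∀ {t} → t ∈ T → x ≤ t) → x ≤ ⋀ T
    ⋁              : Pred Carrier (a ⊔ ℓ) → Carrier
    ⋁-upper        : ∀ T {t} → t ∈ T → t ≤ ⋁ T
    ⋁-least        : ∀ T {x} → (∀ {t} → t ∈ T → t ≤ x) → ⋁ T ≤ x
    _∧_            : Carrier → Carrier → Carrier
    _∨_            : Carrier → Carrier → Carrier
    ∧-infimum      : Infimum _≤_ _∧_
    ∨-supremum     : Supremum _≤_ _∨_
    0#             : Carrier
    1#             : Carrier
    0-least        : ∀ x → 0# ≤ x
    1-greatest     : ∀ x → x ≤ 1#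

IsGlobale : ∀ {a ℓ r} → CompleteLattice a ℓ r → Set (lsuc (a ⊔ ℓ))
IsGlobale {a} {ℓ} L =
  ∀ (w : Carrier) (Z : Pred Carrier (a ⊔ ℓ)) →
    w ∨ ⋀ Z ≡ ⋀ (image (w ∨_) Z)
  where open CompleteLattice L

record Universale (a ℓ r : Level) : Set (lsuc (a ⊔ ℓ ⊔ r)) where
  field
    lattice : CompleteLattice a ℓ r
  open CompleteLattice lattice public
  field
    _∘_       : Carrier → Carrier → Carrier
    0′        : Carrier
    isMonoid  : IsMonoid _≡_ _∘_ 0′
    ∘-⋀-distribˡ : ∀ (b : Carrier) (T : Pred Carrier (a ⊔ ℓ)) →
                   b ∘ ⋀ T ≡ ⋀ (image (b ∘_) T)
    ∘-⋀-distribʳ : ∀ (b : Carrier) (T : Pred Carrier (a ⊔ ℓ)) →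
                   ⋀ T ∘ b ≡ ⋀ (image (_∘ b) T)

module Submission where

-- In a universale whose product ∘ is idempotent and whose monoid unit 0′
-- is the bottom element, the product coincides with binary join:
-- x ∘ y ≡ x ∨ y.  Distributivity of ∘ over arbitrary meets then reads
-- w ∨ ⋀ Z ≡ ⋀ { w ∨ z | z ∈ Z }, which is the globale law.

open import Defs
open import Level using (Level; Lift; lift; _⊔_)
open import Relation.Unary using (Pred)
open import Relation.Binary.PropositionalEquality using (_≡_; refl; sym; trans; cong; module ≡-Reasoning)
open import Data.Product using (_,_; proj₁; proj₂)
open import Data.Sum using (_⊎_; inj₁; inj₂)
open import Relation.Binary.Structures using (IsPartialOrder)
open import Algebra.Structures using (IsMonoid)

module CompleteLatticeFacts {a ℓ r : Level} (L : CompleteLattice a ℓ r) where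
  open CompleteLattice L
  open IsPartialOrder isPartialOrder public
    using (antisym; reflexive; ≲-respˡ-≈; ≲-respʳ-≈)
    renaming (refl to ≤-refl; trans to ≤-trans)

  pair : Carrier → Carrier → Pred Carrier (a ⊔ ℓ)
  pair x y t = Lift ℓ ((t ≡ x) ⊎ (t ≡ y))

  ⋀-pair : ∀ {x y} → x ≤ y → ⋀ (pair x y) ≡ x
  ⋀-pair {x} {y} x≤y = antisym
    (⋀-lower (pair x y) (lift (inj₁ refl)))
    (⋀-greatest (pair x y) λ where
      (lift (inj₁ refl)) → ≤-refl
      (lift (inj₂ refl)) → x≤y)

  -- A map preserving arbitrary meets is monotone: for x ≤ y,
  -- f x ≡ f (⋀ {x, y}) ≡ ⋀ {f x, f y} ≤ f y.
  ⋀-preserving⇒monotone : (f : Carrier → Carrier) →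
    (∀ T → f (⋀ T) ≡ ⋀ (image f T)) →
    ∀ {x y} → x ≤ y → f x ≤ f y
  ⋀-preserving⇒monotone f preserves {x} {y} x≤y =
    ≲-respˡ-≈ f⋀≡fx (⋀-lower (image f (pair x y)) (y , lift (inj₂ refl) , refl))
    where
    f⋀≡fx : ⋀ (image f (pair x y)) ≡ f x
    f⋀≡fx = trans (sym (preserves (pair x y))) (cong f (⋀-pair x≤y))

  ⋀-image-mono : ∀ {f g : Carrier → Carrier} (Z : Pred Carrier (a ⊔ ℓ)) →
    (∀ t → f t ≤ g t) → ⋀ (image f Z) ≤ ⋀ (image g Z)
  ⋀-image-mono Z f≤g = ⋀-greatest _ λ where
    (t , t∈Z , refl) → ≤-trans (⋀-lower _ (t , t∈Z , refl)) (f≤g t)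

  ⋀-image-cong : ∀ {f g : Carrier → Carrier} (Z : Pred Carrier (a ⊔ ℓ)) →
    (∀ t → f t ≡ g t) → ⋀ (image f Z) ≡ ⋀ (image g Z)
  ⋀-image-cong Z f≡g = antisym
    (⋀-image-mono Z (λ t → reflexive (f≡g t)))
    (⋀-image-mono Z (λ t → reflexive (sym (f≡g t))))

module UniversaleFacts {a ℓ r : Level} (U : Universale a ℓ r) where
  open Universale U
  open CompleteLatticeFacts lattice
  open IsMonoid isMonoid using (identityˡ; identityʳ)

  ∘-monoˡ : ∀ b {x y} → x ≤ y → (b ∘ x) ≤ (b ∘ y)
  ∘-monoˡ b = ⋀-preserving⇒monotone (b ∘_) (∘-⋀-distribˡ b)

  ∘-monoʳ : ∀ b {x y} → x ≤ y → (x ∘ b) ≤ (y ∘ b)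
  ∘-monoʳ b = ⋀-preserving⇒monotone (_∘ b) (∘-⋀-distribʳ b)

  -- If the unit 0′ is least, x ∘ y bounds both factors:
  -- x ≡ x ∘ 0′ ≤ x ∘ y and y ≡ 0′ ∘ y ≤ x ∘ y; hence x ∨ y ≤ x ∘ y.
  ∨≤∘ : (∀ x → 0′ ≤ x) → ∀ x y → (x ∨ y) ≤ (x ∘ y)
  ∨≤∘ 0′-least x y = proj₂ (proj₂ (∨-supremum x y)) (x ∘ y)
    (≲-respˡ-≈ (identityʳ x) (∘-monoˡ x (0′-least y)))
    (≲-respˡ-≈ (identityˡ y) (∘-monoʳ y (0′-least x)))

  -- If ∘ is idempotent, x ∘ y ≤ (x ∨ y) ∘ (x ∨ y) ≡ x ∨ y.
  ∘≤∨ : (∀ x → x ∘ x ≡ x) → ∀ x y → (x ∘ y) ≤ (x ∨ y)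
  ∘≤∨ idem x y = ≲-respʳ-≈ (idem (x ∨ y))
    (≤-trans (∘-monoʳ y x≤x∨y) (∘-monoˡ (x ∨ y) y≤x∨y))
    where
    x≤x∨y = proj₁ (∨-supremum x y)
    y≤x∨y = proj₁ (proj₂ (∨-supremum x y))

  ∘≡∨ : (∀ x → x ∘ x ≡ x) → (∀ x → 0′ ≤ x) → ∀ x y → x ∘ y ≡ x ∨ y
  ∘≡∨ idem 0′-least x y = antisym (∘≤∨ idem x y) (∨≤∘ 0′-least x y)

mainTheorem3 : ∀ {a ℓ r : Level} (U : Universale a ℓ r) →
    (∀ x → Universale._∘_ U x x ≡ x) →
    Universale.0# U ≡ Universale.0′ U →
    IsGlobale (Universale.lattice U)
mainTheorem3 U idem 0≡0′ w Z = begin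
  w ∨ ⋀ Z                ≡⟨ sym (∘-is-∨ w (⋀ Z)) ⟩
  w ∘ ⋀ Z                ≡⟨ ∘-⋀-distribˡ w Z ⟩
  ⋀ (image (w ∘_) Z)     ≡⟨ ⋀-image-cong Z (∘-is-∨ w) ⟩
  ⋀ (image (w ∨_) Z)     ∎
  where
  open Universale U
  open UniversaleFacts U
  open CompleteLatticeFacts lattice using (⋀-image-cong; ≲-respˡ-≈)
  open ≡-Reasoning

  ∘-is-∨ : ∀ x y → x ∘ y ≡ x ∨ y
  ∘-is-∨ = ∘≡∨ idem (λ x → ≲-respˡ-≈ 0≡0′ (0-least x))
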